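{- Let $X$ be the Coxeter graph of type $H_n$: a straight line with vertices $s_1,\dots,s_n$, $s_i,s_j$ adjacent iff $|i-j|=1$, $m(s_1,s_2)=5$ and $m(s_i,s_{i+1})=3$ for $i\ge2$. Let $w\in W(X)$ be fully commutative. Then $w$ has no reduced expression of the form $\mathbf{x}(s_is_{i+2}s_{i+1})\mathbf{y}(s_{i+1}s_{i+2}s_i)\mathbf{z}$ in which $\mathbf{y}$ has no occurrences of $s_{i+2}$ or $s_{i+3}$.
   Context: An element is fully commutative if any two of its reduced expressions are related by repeatedly swapping adjacent commuting generators. $\mathbf{x},\mathbf{y},\mathbf{z}$ denote words in the generators. -}

module Defs where

open import Data.Nat using (ℕ; zero; suc; _+_; _≤_; _∸_)
open import Data.Fin using (Fin; toℕ)
open import Data.List using (List; []; _∷_; _++_; length)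
open import Data.List.Membership.Propositional using (_∈_)
open import Data.Product using (Σ; _×_; ∃; ∃-syntax; _,_)
open import Relation.Binary.PropositionalEquality using (_≡_)
open import Relation.Nullary using (¬_)

-- Generators of W(H_n): s_1,…,s_n are represented by Fin n, with s_k ↦ k-1.
-- Words in the generators are lists.
Word : ℕ → Set
Word n = List (Fin n)

dist : ℕ → ℕ → ℕ
dist i j = (i ∸ j) + (j ∸ i)

-- Coxeter matrix of H_n on 0-based indices:
-- m(s,s)=1; m(s_1,s_2)=5; m(s_i,s_{i+1})=3 for i ≥ 2; otherwise 2.
mH : ℕ → ℕ → ℕ
mH i j with dist i j
... | 0 = 1
... | 1 with i + j
...   | 1 = 5
...   | _ = 3
mH i j | _ = 2

alt : ∀ {n} → Fin n → Fin n → ℕ → Word n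
alt a b zero = []
alt a b (suc k) = a ∷ alt b a k

data Cong {n} (R : Word n → Word n → Set) : Word n → Word n → Set where
  c-refl  : ∀ {u} → Cong R u u
  c-sym   : ∀ {u v} → Cong R u v → Cong R v u
  c-trans : ∀ {u v w} → Cong R u v → Cong R v w → Cong R u w
  c-step  : ∀ x {u v} y → R u v → Cong R (x ++ u ++ y) (x ++ v ++ y)

data CoxRel {n} : Word n → Word n → Set where
  quad  : ∀ (a : Fin n) → CoxRel (a ∷ a ∷ []) []
  braid : ∀ (a b : Fin n) → ¬ (a ≡ b) →
          CoxRel (alt a b (mH (toℕ a) (toℕ b))) (alt b a (mH (toℕ a) (toℕ b)))

_≈W_ : ∀ {n} → Word n → Word n → Set
_≈W_ = Cong CoxRel

data CommRel {n} : Word n → Word n → Set where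
  swap : ∀ (a b : Fin n) → mH (toℕ a) (toℕ b) ≡ 2 → CommRel (a ∷ b ∷ []) (b ∷ a ∷ [])

_≈C_ : ∀ {n} → Word n → Word n → Set
_≈C_ = Cong CommRel

Reduced : ∀ {n} → Word n → Set
Reduced u = ∀ v → v ≈W u → length u ≤ length v

FullyCommutative : ∀ {n} → Word n → Set
FullyCommutative w = ∀ u v → Reduced u → Reduced v → u ≈W w → v ≈W w → u ≈C v

-- Call a word forbidden if it is not a factor of any reduced expression of w, and write
-- r, a, b, c for s_k, s_{k+1}, s_{k+2}, s_{k+3}.  A word commutation-equivalent to a forbidden
-- one is forbidden, and so are a square s s (it can be shortened) and a braid s t s or
-- s t s t s: the braid relation turns it into another reduced expression of w, and as w is
-- fully commutative the two would be commutation-equivalent, yet they contain different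
-- numbers of letters s.  That a c b Y b c a is forbidden is proved by induction on k: moving
-- letters that commute with a or b out of the way, one reaches a square, a braid, or (when
-- k > 0) the factor r b a Y' a b r, forbidden by the induction hypothesis; at k = 0 the braid
-- that appears is a b a b a, since m(s_1, s_2) = 5.

module Submission where

open import Defs
open import Data.Fin using (Fin; toℕ; _≟_) renaming (pred to predecessor)
import Data.Fin as Fin
open import Data.Fin.Properties using (toℕ-injective; toℕ-inject₁)
open import Data.List using ([]; _∷_; _++_; length; filter)
open import Data.List.Membership.Propositional using (_∈_)
open import Data.List.Properties using (++-assoc; length-++; filter-++; filter-accept; filter-reject)
open import Data.List.Relation.Unary.All using (All; []; _∷_; tabulate) renaming (map to mapᴬ)
open import Data.List.Relation.Unary.All.Properties using (++⁺)
open import Data.List.Relation.Binary.Permutation.Propositional using (_↭_; ↭-refl; ↭-sym; ↭-trans; swap)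
open import Data.List.Relation.Binary.Permutation.Propositional.Properties using (↭-length; filter-↭; ++⁺ˡ)
import Data.Nat as ℕ
open import Data.Nat using (ℕ; zero; suc; _+_; _∸_; _≤_; _<_; z≤n; s≤s; s≤s⁻¹; parity)
open import Data.Nat.Properties
  using (+-comm; +-suc; +-cancelˡ-≡; +-cancelʳ-≡; +-monoʳ-<; ≤-refl; ≤-trans; <-≤-trans; ≤-<-trans;
         ≤∧≢⇒<; <⇒≱; n≤1+n; n<1+n; m≤n+m; n∸n≡0; 1+n≢n; suc-injective; <-cmp)
open import Data.Parity.Base using (1ℙ)
open import Data.Product using (_×_; ∃-syntax; _,_; proj₁; proj₂)
open import Data.Sum using (_⊎_; inj₁; inj₂)
open import Function using (_∘_)
open import Relation.Binary.Definitions using (tri<; tri≈; tri>)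
open import Relation.Binary.PropositionalEquality
  using (_≡_; _≢_; refl; sym; trans; cong; subst; subst₂; module ≡-Reasoning)
open import Relation.Nullary using (¬_; yes; no; contradiction)

dist-self : ∀ i → dist i i ≡ 0
dist-self i rewrite n∸n≡0 i = refl

dist-comm : ∀ i j → dist i j ≡ dist j i
dist-comm i j = +-comm (i ∸ j) (j ∸ i)

dist-suc : ∀ i → dist i (suc i) ≡ 1
dist-suc zero = refl
dist-suc (suc i) = dist-suc i

dist-apart : ∀ {i j} → suc i < j → 2 ≤ dist i j
dist-apart {zero} {suc zero} (s≤s ())
dist-apart {zero} {suc (suc j)} _ = s≤s (s≤s z≤n)
dist-apart {suc i} {suc j} i+1<j = dist-apart (s≤s⁻¹ i+1<j)

mH-diag : ∀ i → mH i i ≡ 1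
mH-diag i with dist i i | dist-self i
... | .0 | refl = refl

mH-apart : ∀ i j → 2 ≤ dist i j → mH i j ≡ 2
mH-apart i j h with dist i j
mH-apart i j (s≤s (s≤s _)) | suc (suc _) = refl

mH-adjacent : ∀ i j → dist i j ≡ 1 → mH (suc i) (suc j) ≡ 3
mH-adjacent i j d with dist i j
mH-adjacent i j refl | .1 rewrite +-suc i j = refl

toℕ-predecessor : ∀ {m k} (a : Fin m) → toℕ a ≡ suc k → toℕ (predecessor a) ≡ k
toℕ-predecessor (Fin.suc i) eq = trans (toℕ-inject₁ i) (suc-injective eq)

module _ {n : ℕ} where

  Commute : Fin n → Fin n → Set
  Commute e d = mH (toℕ e) (toℕ d) ≡ 2

  commute-apart : ∀ {e d : Fin n} → suc (toℕ e) < toℕ d ⊎ suc (toℕ d) < toℕ e → Commute e d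
  commute-apart {e} {d} (inj₁ e+1<d) = mH-apart (toℕ e) (toℕ d) (dist-apart e+1<d)
  commute-apart {e} {d} (inj₂ d+1<e) =
    mH-apart (toℕ e) (toℕ d) (subst (2 ≤_) (dist-comm (toℕ d) (toℕ e)) (dist-apart d+1<e))

  commute-≢ : ∀ {e d : Fin n} → Commute e d → e ≢ d
  commute-≢ {e} h refl with trans (sym (mH-diag (toℕ e))) h
  ... | ()

  Outside : ℕ → ℕ → Fin n → Set
  Outside lo hi d = toℕ d < lo ⊎ hi < toℕ d

  outside-mono : ∀ {lo hi lo′ hi′ d} → lo ≤ lo′ → hi′ ≤ hi →
                 Outside lo hi d → Outside lo′ hi′ d
  outside-mono lo≤lo′ _ (inj₁ d<lo) = inj₁ (<-≤-trans d<lo lo≤lo′)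
  outside-mono _ hi′≤hi (inj₂ hi<d) = inj₂ (≤-<-trans hi′≤hi hi<d)

  outside-commute : ∀ {lo hi i e d} → toℕ e ≡ i → lo < i → i < hi → Outside lo hi d → Commute e d
  outside-commute refl lo<e _ (inj₁ d<lo) = commute-apart (inj₂ (≤-<-trans d<lo lo<e))
  outside-commute refl _ e<hi (inj₂ hi<d) = commute-apart (inj₁ (≤-<-trans e<hi hi<d))

  outside-widen : ∀ {lo hi d} → Outside (suc lo) hi d → toℕ d ≢ lo → Outside lo hi d
  outside-widen (inj₁ d<1+lo) d≢lo = inj₁ (≤∧≢⇒< (s≤s⁻¹ d<1+lo) d≢lo)
  outside-widen (inj₂ hi<d) _ = inj₂ hi<d

  outside-≢ : ∀ {lo d} → toℕ d ≢ lo → toℕ d ≢ suc lo → Outside lo (suc lo) d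
  outside-≢ {lo} {d} d≢lo d≢1+lo with <-cmp (toℕ d) lo
  ... | tri< d<lo _ _ = inj₁ d<lo
  ... | tri≈ _ d≡lo _ = contradiction d≡lo d≢lo
  ... | tri> _ _ lo<d = inj₂ (≤∧≢⇒< lo<d (d≢1+lo ∘ sym))

  data Split (P Q : Fin n → Set) (e : Fin n) : Word n → Set where
    split : ∀ {u₁ u₂} → All P u₁ → All Q u₂ → Split P Q e (u₁ ++ e ∷ u₂)

  first-occurrence : ∀ {lo hi} (e : Fin n) → toℕ e ≡ lo → ∀ u → All (Outside (suc lo) hi) u →
                     All (Outside lo hi) u ⊎ Split (Outside lo hi) (Outside (suc lo) hi) e u
  first-occurrence e e≡lo [] [] = inj₁ []
  first-occurrence {lo} e e≡lo (d ∷ u) (o ∷ os) with toℕ d ℕ.≟ lo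
  ... | yes d≡lo with toℕ-injective (trans d≡lo (sym e≡lo))
  ...   | refl = inj₂ (split [] os)
  first-occurrence e e≡lo (d ∷ u) (o ∷ os) | no d≢lo with first-occurrence e e≡lo u os
  ...   | inj₁ os′ = inj₁ (outside-widen o d≢lo ∷ os′)
  ...   | inj₂ (split os₁ os₂) = inj₂ (split (outside-widen o d≢lo ∷ os₁) os₂)

  last-occurrence : ∀ {lo hi} (e : Fin n) → toℕ e ≡ lo → ∀ u → All (Outside (suc lo) hi) u →
                    All (Outside lo hi) u ⊎ Split (Outside (suc lo) hi) (Outside lo hi) e u
  last-occurrence e e≡lo [] [] = inj₁ []
  last-occurrence {lo} e e≡lo (d ∷ u) (o ∷ os) with last-occurrence e e≡lo u os
  ... | inj₂ (split os₁ os₂) = inj₂ (split (o ∷ os₁) os₂)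
  ... | inj₁ os′ with toℕ d ℕ.≟ lo
  ...   | no d≢lo = inj₁ (outside-widen o d≢lo ∷ os′)
  ...   | yes d≡lo with toℕ-injective (trans d≡lo (sym e≡lo))
  ...     | refl = inj₂ (split [] os′)

  module _ {R : Word n → Word n → Set} where

    Cong-∷ : ∀ d {u v} → Cong R u v → Cong R (d ∷ u) (d ∷ v)
    Cong-∷ d c-refl = c-refl
    Cong-∷ d (c-sym p) = c-sym (Cong-∷ d p)
    Cong-∷ d (c-trans p q) = c-trans (Cong-∷ d p) (Cong-∷ d q)
    Cong-∷ d (c-step x y r) = c-step (d ∷ x) y r

    Cong-++ˡ : ∀ p {u v} → Cong R u v → Cong R (p ++ u) (p ++ v)
    Cong-++ˡ [] e = e
    Cong-++ˡ (d ∷ p) e = Cong-∷ d (Cong-++ˡ p e)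

  ≈C⇒≈W : ∀ {u v : Word n} → u ≈C v → u ≈W v
  ≈C⇒≈W c-refl = c-refl
  ≈C⇒≈W (c-sym p) = c-sym (≈C⇒≈W p)
  ≈C⇒≈W (c-trans p q) = c-trans (≈C⇒≈W p) (≈C⇒≈W q)
  ≈C⇒≈W (c-step x y (swap a b h)) =
    c-step x y (subst (λ m → CoxRel (alt a b m) (alt b a m)) h (braid a b (commute-≢ h)))

  ≈C⇒↭ : ∀ {u v : Word n} → u ≈C v → u ↭ v
  ≈C⇒↭ c-refl = ↭-refl
  ≈C⇒↭ (c-sym p) = ↭-sym (≈C⇒↭ p)
  ≈C⇒↭ (c-trans p q) = ↭-trans (≈C⇒↭ p) (≈C⇒↭ q)
  ≈C⇒↭ (c-step x y (swap a b _)) = ++⁺ˡ x (swap a b ↭-refl)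

  move-right : ∀ {e t} Z → All (Commute e) Z → (e ∷ Z ++ t) ≈C (Z ++ e ∷ t)
  move-right [] [] = c-refl
  move-right {e} (d ∷ Z) (h ∷ hs) = c-trans (c-step [] _ (swap e d h)) (Cong-∷ d (move-right Z hs))

  move-pair-right : ∀ {e f t} Z → All (Commute e) Z → All (Commute f) Z →
                    (e ∷ f ∷ Z ++ t) ≈C (Z ++ e ∷ f ∷ t)
  move-pair-right {e} Z he hf = c-trans (Cong-∷ e (move-right Z hf)) (move-right Z he)

  occurrences : Fin n → Word n → ℕ
  occurrences s u = length (filter (_≟ s) u)

  occurrences-↭ : ∀ s {u v} → u ↭ v → occurrences s u ≡ occurrences s v
  occurrences-↭ s = ↭-length ∘ filter-↭ (_≟ s)

  occurrences-++ : ∀ s u v → occurrences s (u ++ v) ≡ occurrences s u + occurrences s v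
  occurrences-++ s u v = trans (cong length (filter-++ (_≟ s) u v)) (length-++ (filter (_≟ s) u))

  occurrences-infix : ∀ s p u q →
                      occurrences s (p ++ u ++ q) ≡ occurrences s p + (occurrences s u + occurrences s q)
  occurrences-infix s p u q =
    trans (occurrences-++ s p (u ++ q)) (cong (occurrences s p +_) (occurrences-++ s u q))

  occurrences-here : ∀ s l → occurrences s (s ∷ l) ≡ suc (occurrences s l)
  occurrences-here s l = cong length (filter-accept (_≟ s) refl)

  occurrences-there : ∀ {s t} l → t ≢ s → occurrences s (t ∷ l) ≡ occurrences s l
  occurrences-there {s} l t≢s = cong length (filter-reject (_≟ s) t≢s)

  occurrences-alt-odd : ∀ {s t} → s ≢ t → ∀ m → parity m ≡ 1ℙ →
                        occurrences s (alt s t m) ≡ suc (occurrences s (alt t s m))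
  occurrences-alt-odd {s} {t} s≢t (suc zero) _ =
    trans (occurrences-here s []) (cong suc (sym (occurrences-there [] (s≢t ∘ sym))))
  occurrences-alt-odd {s} {t} s≢t (suc (suc m)) odd = begin
    occurrences s (s ∷ t ∷ alt s t m)        ≡⟨ occurrences-here s _ ⟩
    suc (occurrences s (t ∷ alt s t m))      ≡⟨ cong suc (occurrences-there _ (s≢t ∘ sym)) ⟩
    suc (occurrences s (alt s t m))          ≡⟨ cong suc (occurrences-alt-odd s≢t m odd) ⟩
    suc (suc (occurrences s (alt t s m)))    ≡⟨ cong suc (occurrences-here s _) ⟨
    suc (occurrences s (s ∷ alt t s m))      ≡⟨ cong suc (occurrences-there _ (s≢t ∘ sym)) ⟨
    suc (occurrences s (t ∷ s ∷ alt t s m))  ∎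
    where open ≡-Reasoning

reduced-resp-≈W : ∀ {n} {u v : Word n} → u ≈W v → length u ≡ length v → Reduced u → Reduced v
reduced-resp-≈W {v = v} u≈v |u|≡|v| red v′ v′≈v =
  subst (_≤ length v′) |u|≡|v| (red v′ (c-trans v′≈v (c-sym u≈v)))

length-infix : ∀ {n} (p : Word n) {u v} q → length u ≡ length v →
               length (p ++ u ++ q) ≡ length (p ++ v ++ q)
length-infix [] {u} {v} q |u|≡|v| =
  trans (length-++ u) (trans (cong (_+ length q) |u|≡|v|) (sym (length-++ v)))
length-infix (_ ∷ p) q |u|≡|v| = cong suc (length-infix p q |u|≡|v|)

length-alt : ∀ {n} (s t : Fin n) m → length (alt s t m) ≡ m
length-alt s t zero = refl
length-alt s t (suc m) = cong suc (length-alt t s m)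

module Obstructions {n : ℕ} (w : Word n) (fc : FullyCommutative w) where

  IsReducedExpr : Word n → Set
  IsReducedExpr u = Reduced u × u ≈W w

  ForbiddenSuffix : Word n → Set
  ForbiddenSuffix u = ∀ p → ¬ IsReducedExpr (p ++ u)

  forbidden-resp : ∀ {u v} → u ≈C v → ForbiddenSuffix v → ForbiddenSuffix u
  forbidden-resp u≈v forbidden p (red , pu≈w) =
    forbidden p ( reduced-resp-≈W (≈C⇒≈W pu≈pv) (↭-length (≈C⇒↭ pu≈pv)) red
                , c-trans (c-sym (≈C⇒≈W pu≈pv)) pu≈w)
    where pu≈pv = Cong-++ˡ p u≈v

  forbidden-++ˡ : ∀ v {u} → ForbiddenSuffix u → ForbiddenSuffix (v ++ u)
  forbidden-++ˡ v {u} forbidden p = forbidden (p ++ v) ∘ subst IsReducedExpr (sym (++-assoc p v u))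

  forbidden-square : ∀ s t → ForbiddenSuffix (s ∷ s ∷ t)
  forbidden-square s t p (red , _) = <⇒≱ shorter (red (p ++ t) (c-sym (c-step p t (quad s))))
    where
    shorter : length (p ++ t) < length (p ++ s ∷ s ∷ t)
    shorter = subst₂ _<_ (sym (length-++ p)) (sym (length-++ p)) (+-monoʳ-< (length p) (s≤s (n≤1+n _)))

  forbidden-commuting-square : ∀ s Z t → All (Commute s) Z → ForbiddenSuffix (s ∷ Z ++ s ∷ t)
  forbidden-commuting-square s Z t hs = forbidden-resp (move-right Z hs) (forbidden-++ˡ Z (forbidden-square s t))

  forbidden-braid : ∀ {s t m} → s ≢ t → mH (toℕ s) (toℕ t) ≡ m → parity m ≡ 1ℙ → ∀ T →
                    ForbiddenSuffix (alt s t m ++ T)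
  forbidden-braid {s} {t} {m} s≢t mH≡m odd T p (red , u≈w) =
    1+n≢n (trans (sym (occurrences-alt-odd s≢t m odd)) same-count)
    where
    u v : Word n
    u = p ++ alt s t m ++ T
    v = p ++ alt t s m ++ T
    u≈v : u ≈W v
    u≈v = c-step p T (subst (λ m → CoxRel (alt s t m) (alt t s m)) mH≡m (braid s t s≢t))
    v-red : Reduced v
    v-red = reduced-resp-≈W u≈v (length-infix p T (trans (length-alt s t m) (sym (length-alt t s m)))) red
    u≈Cv : u ≈C v
    u≈Cv = fc u v red v-red u≈w (c-trans (c-sym u≈v) u≈w)
    same-count : occurrences s (alt s t m) ≡ occurrences s (alt t s m)
    same-count = +-cancelʳ-≡ (occurrences s T) _ _ (+-cancelˡ-≡ (occurrences s p) _ _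
                   (trans (sym (occurrences-infix s p (alt s t m) T))
                          (trans (occurrences-↭ s (≈C⇒↭ u≈Cv)) (occurrences-infix s p (alt t s m) T))))

  -- Names spell out the words, lower case letters being generators and upper case ones
  -- subwords; the final subword T is arbitrary.
  Forbidden-acbYbca : ℕ → Set
  Forbidden-acbYbca k = ∀ {a b c : Fin n} → toℕ a ≡ k → toℕ b ≡ suc k → toℕ c ≡ 2 + k →
                        ∀ Y T → All (Outside (2 + k) (3 + k)) Y →
                        ForbiddenSuffix (a ∷ c ∷ b ∷ Y ++ b ∷ c ∷ a ∷ T)

  module Level (k : ℕ) {a b c : Fin n} (ea : toℕ a ≡ k) (eb : toℕ b ≡ suc k) (ec : toℕ c ≡ 2 + k) where

    Free NotB : Fin n → Set
    Free = Outside k (3 + k)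
    NotB = Outside (suc k) (3 + k)

    b-commutes : ∀ {d} → Free d → Commute b d
    b-commutes = outside-commute eb (n<1+n k) (s≤s (s≤s (n≤1+n k)))

    a+1<c : suc (toℕ a) < toℕ c
    a+1<c rewrite ea | ec = ≤-refl

    a-past-cY : ∀ Y {T} → All (Commute a) Y → (a ∷ c ∷ Y ++ T) ≈C (c ∷ Y ++ a ∷ T)
    a-past-cY Y hs = move-right (c ∷ Y) (commute-apart (inj₁ a+1<c) ∷ hs)

    a≢b : a ≢ b
    a≢b a≡b = 1+n≢n (trans (sym eb) (trans (cong toℕ (sym a≡b)) ea))

    Forbidden-acbGbPa : Set
    Forbidden-acbGbPa = ∀ G P T → All NotB G → All Free P →
                        ForbiddenSuffix (a ∷ c ∷ b ∷ G ++ b ∷ P ++ a ∷ T)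

    Forbidden-acYbaGbPa : Set
    Forbidden-acYbaGbPa = ∀ Y G P T → All Free Y → All NotB G → All Free P →
                          ForbiddenSuffix (a ∷ c ∷ Y ++ b ∷ a ∷ G ++ b ∷ P ++ a ∷ T)

    acYbaGbPa⇒acbGbPa : Forbidden-acYbaGbPa → Forbidden-acbGbPa
    acYbaGbPa⇒acbGbPa forbidden-acYbaGbPa G P T oG oP with first-occurrence a ea G oG
    ... | inj₁ oG′ =
      forbidden-++ˡ (a ∷ c ∷ []) (forbidden-commuting-square b G _ (mapᴬ b-commutes oG′))
    ... | inj₂ (split {Y} {G′} oY oG′) rewrite ++-assoc Y (a ∷ G′) (b ∷ P ++ a ∷ T) =
      forbidden-resp (Cong-++ˡ (a ∷ c ∷ []) (move-right Y (mapᴬ b-commutes oY)))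
        (forbidden-acYbaGbPa Y G′ P T oY oG′ oP)

    forbidden-acbGbRb : Forbidden-acbGbPa → ∀ G R T → All NotB G → All NotB R →
                        ForbiddenSuffix (a ∷ c ∷ b ∷ G ++ b ∷ R ++ b ∷ T)
    forbidden-acbGbRb forbidden-acbGbPa G R T oG oR with first-occurrence a ea R oR
    ... | inj₁ oR′ =
      forbidden-++ˡ (a ∷ c ∷ b ∷ G) (forbidden-commuting-square b R T (mapᴬ b-commutes oR′))
    ... | inj₂ (split {P} {Q} oP _) rewrite ++-assoc P (a ∷ Q) (b ∷ T) =
      forbidden-acbGbPa G P (Q ++ b ∷ T) oG oP

    acbGbPa⇒acbYbca : Forbidden-acbGbPa → ∀ Y T → All (Outside (2 + k) (3 + k)) Y →
                      ForbiddenSuffix (a ∷ c ∷ b ∷ Y ++ b ∷ c ∷ a ∷ T)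
    acbGbPa⇒acbYbca forbidden-acbGbPa Y T oY with first-occurrence b eb Y oY
    ... | inj₁ oY′ =
      forbidden-resp
        (Cong-++ˡ (a ∷ c ∷ b ∷ Y) (Cong-∷ b (move-right (a ∷ []) (commute-apart (inj₂ a+1<c) ∷ []))))
        (forbidden-acbGbPa Y [] (c ∷ T) oY′ [])
    ... | inj₂ (split {G} {R} oG oR) rewrite ++-assoc G (b ∷ R) (b ∷ c ∷ a ∷ T)
      with first-occurrence b eb R oR
    ...   | inj₁ oR′ = forbidden-acbGbRb forbidden-acbGbPa G R (c ∷ a ∷ T) oG oR′
    ...   | inj₂ (split {R₁} {R₂} oR₁ _) rewrite ++-assoc R₁ (b ∷ R₂) (b ∷ c ∷ a ∷ T) =
      forbidden-acbGbRb forbidden-acbGbPa G R₁ (R₂ ++ b ∷ c ∷ a ∷ T) oG oR₁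

  module Base {a b c : Fin n} (ea : toℕ a ≡ 0) (eb : toℕ b ≡ 1) (ec : toℕ c ≡ 2) where
    open Level 0 ea eb ec

    a-commutes : ∀ {d} → Free d → Commute a d
    a-commutes {d} (inj₂ 3<d) =
      commute-apart (inj₁ (subst (λ i → suc i < toℕ d) (sym ea) (≤-trans (s≤s (s≤s z≤n)) 3<d)))

    mH-ab : mH (toℕ a) (toℕ b) ≡ 5
    mH-ab rewrite ea | eb = refl

    gather-ba : ∀ G P T → All Free G → All Free P →
                (G ++ b ∷ P ++ a ∷ T) ≈C (b ∷ a ∷ G ++ P ++ T)
    gather-ba G P T oG oP =
      c-trans (c-sym (move-right G (mapᴬ b-commutes oG)))
        (Cong-∷ b (c-trans (Cong-++ˡ G (c-sym (move-right P (mapᴬ a-commutes oP))))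
                           (c-sym (move-right G (mapᴬ a-commutes oG)))))

    forbidden-acYbaGbPa : Forbidden-acYbaGbPa
    forbidden-acYbaGbPa Y G P T oY oG oP with first-occurrence a ea G oG
    ... | inj₁ oG′ =
      forbidden-resp (a-past-cY Y (mapᴬ a-commutes oY))
        (forbidden-++ˡ (c ∷ Y) (forbidden-resp (Cong-++ˡ (a ∷ b ∷ a ∷ []) (gather-ba G P T oG′ oP))
          (forbidden-braid a≢b mH-ab refl (G ++ P ++ T))))
    ... | inj₂ (split {G₁} {G₂} oG₁ _) rewrite ++-assoc G₁ (a ∷ G₂) (b ∷ P ++ a ∷ T) =
      forbidden-++ˡ (a ∷ c ∷ Y) (forbidden-++ˡ (b ∷ [])
        (forbidden-commuting-square a G₁ _ (mapᴬ a-commutes oG₁)))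

  module Step (k : ℕ) (forbidden-rbaYabr : Forbidden-acbYbca k) {r a b c : Fin n}
              (er : toℕ r ≡ k) (ea : toℕ a ≡ suc k) (eb : toℕ b ≡ 2 + k) (ec : toℕ c ≡ 3 + k) where
    open Level (suc k) ea eb ec

    NotR NotBC : Fin n → Set
    NotR = Outside k (4 + k)
    NotBC = Outside (2 + k) (3 + k)

    NotR⇒NotBC : ∀ {d} → NotR d → NotBC d
    NotR⇒NotBC = outside-mono (m≤n+m k 2) (n≤1+n _)

    a-commutes : ∀ {d} → NotR d → Commute a d
    a-commutes = outside-commute ea (n<1+n k) (s≤s (s≤s (m≤n+m k 2)))

    b-commutes-NotR : ∀ {d} → NotR d → Commute b d
    b-commutes-NotR = b-commutes ∘ outside-mono (n≤1+n k) ≤-refl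

    ab-past : ∀ Z {T} → All NotR Z → (a ∷ b ∷ Z ++ T) ≈C (Z ++ a ∷ b ∷ T)
    ab-past Z oZ = move-pair-right Z (mapᴬ a-commutes oZ) (mapᴬ b-commutes-NotR oZ)

    ba-past : ∀ Z {T} → All NotR Z → (b ∷ a ∷ Z ++ T) ≈C (Z ++ b ∷ a ∷ T)
    ba-past Z oZ = move-pair-right Z (mapᴬ b-commutes-NotR oZ) (mapᴬ a-commutes oZ)

    mH-ab : mH (toℕ a) (toℕ b) ≡ 3
    mH-ab rewrite ea | eb = mH-adjacent k (suc k) (dist-suc k)

    mH-ba : mH (toℕ b) (toℕ a) ≡ 3
    mH-ba rewrite ea | eb = mH-adjacent (suc k) k (trans (dist-comm (suc k) k) (dist-suc k))

    forbidden-acYbaMabr : ∀ Y M T → All Free Y → All NotBC M →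
                          ForbiddenSuffix (a ∷ c ∷ Y ++ b ∷ a ∷ M ++ a ∷ b ∷ r ∷ T)
    forbidden-acYbaMabr Y M T oY oM with last-occurrence r er Y oY
    ... | inj₁ oY′ =
      forbidden-resp (a-past-cY Y (mapᴬ a-commutes oY′))
        (forbidden-++ˡ (c ∷ Y) (forbidden-braid a≢b mH-ab refl _))
    ... | inj₂ (split {Y₁} {Y₂} _ oY₂)
      rewrite ++-assoc Y₁ (r ∷ Y₂) (b ∷ a ∷ M ++ a ∷ b ∷ r ∷ T) =
      forbidden-++ˡ (a ∷ c ∷ Y₁) (forbidden-resp (Cong-∷ r (c-sym (ba-past Y₂ oY₂)))
        (subst (λ V → ForbiddenSuffix (r ∷ b ∷ a ∷ V)) (++-assoc Y₂ M (a ∷ b ∷ r ∷ T))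
          (forbidden-rbaYabr er ea eb (Y₂ ++ M) T (++⁺ (mapᴬ NotR⇒NotBC oY₂) oM))))

    forbidden-acYbaMabQa : ∀ Y M Q T → All Free Y → All NotBC M → All Free Q →
                           ForbiddenSuffix (a ∷ c ∷ Y ++ b ∷ a ∷ M ++ a ∷ b ∷ Q ++ a ∷ T)
    forbidden-acYbaMabQa Y M Q T oY oM oQ with first-occurrence r er Q oQ
    ... | inj₁ oQ′ =
      forbidden-++ˡ (a ∷ c ∷ Y) (forbidden-++ˡ (b ∷ a ∷ M)
        (forbidden-resp (ab-past Q oQ′) (forbidden-++ˡ Q (forbidden-braid a≢b mH-ab refl T))))
    ... | inj₂ (split {Q₁} {Q₂} oQ₁ _) rewrite ++-assoc Q₁ (r ∷ Q₂) (a ∷ T) =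
      forbidden-resp (Cong-++ˡ (a ∷ c ∷ Y) (Cong-++ˡ (b ∷ a ∷ M) (ab-past Q₁ oQ₁)))
        (subst (λ V → ForbiddenSuffix (a ∷ c ∷ Y ++ b ∷ a ∷ V))
               (++-assoc M Q₁ (a ∷ b ∷ r ∷ Q₂ ++ a ∷ T))
          (forbidden-acYbaMabr Y (M ++ Q₁) (Q₂ ++ a ∷ T) oY (++⁺ oM (mapᴬ NotR⇒NotBC oQ₁))))

    forbidden-acYbaGbPa : Forbidden-acYbaGbPa
    forbidden-acYbaGbPa Y G P T oY oG oP with last-occurrence a ea G oG
    ... | inj₁ oG′ =
      forbidden-++ˡ (a ∷ c ∷ Y)
        (forbidden-resp (Cong-++ˡ (b ∷ a ∷ []) (c-sym (move-right G (mapᴬ b-commutes oG′))))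
          (forbidden-braid (a≢b ∘ sym) mH-ba refl _))
    ... | inj₂ (split {M} {N} oM oN) rewrite ++-assoc M (a ∷ N) (b ∷ P ++ a ∷ T) =
      forbidden-resp
        (Cong-++ˡ (a ∷ c ∷ Y) (Cong-++ˡ (b ∷ a ∷ M) (Cong-∷ a (c-sym (move-right N (mapᴬ b-commutes oN))))))
        (subst (λ V → ForbiddenSuffix (a ∷ c ∷ Y ++ b ∷ a ∷ M ++ a ∷ b ∷ V))
               (++-assoc N P (a ∷ T))
          (forbidden-acYbaMabQa Y M (N ++ P) T oY (mapᴬ (outside-mono ≤-refl (n≤1+n _)) oM) (++⁺ oN oP)))

  forbidden-acbYbca : ∀ k → Forbidden-acbYbca k
  forbidden-acbYbca zero ea eb ec =
    Level.acbGbPa⇒acbYbca 0 ea eb ec (Level.acYbaGbPa⇒acbGbPa 0 ea eb ec (Base.forbidden-acYbaGbPa ea eb ec))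
  forbidden-acbYbca (suc k) {a} ea eb ec =
    Level.acbGbPa⇒acbYbca (suc k) ea eb ec (Level.acYbaGbPa⇒acbGbPa (suc k) ea eb ec
      (Step.forbidden-acYbaGbPa k (forbidden-acbYbca k) {r = predecessor a} (toℕ-predecessor a ea) ea eb ec))

lemma4p3p5 : ∀ (n : ℕ) (w : Word n) → FullyCommutative w →
    ¬ (∃[ x ] ∃[ y ] ∃[ z ] ∃[ a ] ∃[ b ] ∃[ c ]
        (toℕ b ≡ toℕ a + 1) × (toℕ c ≡ toℕ a + 2) ×
        (∀ d → d ∈ y → ¬ (toℕ d ≡ toℕ a + 2) × ¬ (toℕ d ≡ toℕ a + 3)) ×
        Reduced (x ++ (a ∷ c ∷ b ∷ []) ++ y ++ (b ∷ c ∷ a ∷ []) ++ z) ×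
        ((x ++ (a ∷ c ∷ b ∷ []) ++ y ++ (b ∷ c ∷ a ∷ []) ++ z) ≈W w))
lemma4p3p5 n w fc (x , y , z , a , b , c , eb , ec , y-avoids , reduced , word≈w) =
  Obstructions.forbidden-acbYbca w fc (toℕ a) refl (trans eb (+-comm _ 1)) (trans ec (+-comm _ 2))
    y z oy x (reduced , word≈w)
  where
  oy : All (Outside (2 + toℕ a) (3 + toℕ a)) y
  oy = tabulate λ {d} d∈y →
    outside-≢ (proj₁ (y-avoids d d∈y) ∘ (λ e → trans e (+-comm 2 (toℕ a))))
              (proj₂ (y-avoids d d∈y) ∘ (λ e → trans e (+-comm 3 (toℕ a))))
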